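{- Let $G$ be a threshold graph with binary string $b=0^{s_1}1^{t_1}0^{s_2}1^{t_2}\cdots0^{s_k}1^{t_k}$, where $k\ge1$ and all $s_i,t_i\ge1$, and let $S$ be its Seidel matrix. Let $n_{+1}(S)$ denote the multiplicity of $1$ as an eigenvalue of $S$. Then $$n_{+1}(S)=\begin{cases}\sum_{i=1}^k t_i-k, & \text{if } s_1>1,\\ \sum_{i=1}^k t_i-k+1, & \text{if } s_1=1.\end{cases}$$
   Context: A threshold graph is built from a single vertex by repeatedly adding either an isolated vertex or a dominating vertex; its binary string $\alpha_1\cdots\alpha_n$ has $\alpha_1=0$ and, for $i\ge2$, $\alpha_i=0$ if the $i$-th vertex was added isolated and $\alpha_i=1$ if added dominating (adjacent to all earlier vertices). The notation $0^{s}$ (resp. $1^{t}$) denotes a run of $s$ zeros (resp. $t$ ones). The Seidel matrix of a graph with adjacency matrix $A$ is $S=J-I-2A$, with $J$ the all-ones matrix. -}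

module Defs where

open import Data.Nat as ℕ using (ℕ; zero; suc)
open import Data.Bool using (Bool; true; false; if_then_else_)
open import Data.Fin using (Fin; zero; suc; toℕ; _<?_)
open import Data.Fin.Properties using (_≟_)
open import Data.List using (List; []; _∷_; _++_; replicate; concatMap; length; lookup; map; allFin)
open import Data.Nat.ListAction using (sum)
open import Data.Rational using (ℚ; 0ℚ; 1ℚ; _+_; _*_; -_)
open import Data.Product using (Σ; _×_; _,_)
open import Relation.Nullary using (¬_; yes; no)
open import Relation.Binary.PropositionalEquality using (_≡_)

-- Binary string 0^{s_1} 1^{t_1} ... 0^{s_k} 1^{t_k} of a threshold graph,
-- with k blocks given by s t : Fin k → ℕ  (false = 0, true = 1).
thresholdString : (k : ℕ) → (Fin k → ℕ) → (Fin k → ℕ) → List Bool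
thresholdString k s t = concatMap (λ i → replicate (s i) false ++ replicate (t i) true) (allFin k)

-- Adjacency in the threshold graph with string α (vertices 0..n-1 in order of addition):
-- distinct i, j are adjacent iff the later of the two was added as dominating vertex.
thrAdj : (n : ℕ) → (Fin n → Bool) → Fin n → Fin n → Bool
thrAdj n α i j with i ≟ j
... | yes _ = false
... | no _ with i <? j
...   | yes _ = α j
...   | no _  = α i

-- Seidel matrix S = J - I - 2A as a ℚ-matrix.
seidel : (n : ℕ) → (Fin n → Fin n → Bool) → Fin n → Fin n → ℚ
seidel n A i j with i ≟ j
... | yes _ = 0ℚ
... | no _ = if A i j then - 1ℚ else 1ℚ

thresholdSeidel : (b : List Bool) → Fin (length b) → Fin (length b) → ℚ
thresholdSeidel b = seidel (length b) (thrAdj (length b) (lookup b))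

Σℚ : (n : ℕ) → (Fin n → ℚ) → ℚ
Σℚ zero f = 0ℚ
Σℚ (suc n) f = f zero + Σℚ n (λ i → f (suc i))

InEigenspace : (n : ℕ) → (Fin n → Fin n → ℚ) → ℚ → (Fin n → ℚ) → Set
InEigenspace n M λ' v = (i : Fin n) → Σℚ n (λ j → M i j * v j) ≡ λ' * v i

LinearlyIndependent : (n d : ℕ) → (Fin d → Fin n → ℚ) → Set
LinearlyIndependent n d vs =
  (c : Fin d → ℚ) → ((i : Fin n) → Σℚ d (λ a → c a * vs a i) ≡ 0ℚ) → (a : Fin d) → c a ≡ 0ℚ

-- The multiplicity of λ as an eigenvalue of M is m, i.e. the eigenspace
-- of λ has dimension m: it contains m linearly independent vectors but
-- not m+1.  (For symmetric real matrices this equals the algebraic multiplicity.)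
EigenvalueMultiplicity : (n : ℕ) → (Fin n → Fin n → ℚ) → ℚ → ℕ → Set
EigenvalueMultiplicity n M λ' m =
  Σ (Fin m → Fin n → ℚ) (λ vs → ((a : Fin m) → InEigenspace n M λ' (vs a)) × LinearlyIndependent n m vs)
  × ((ws : Fin (suc m) → Fin n → ℚ) → ((a : Fin (suc m)) → InEigenspace n M λ' (ws a)) → ¬ LinearlyIndependent n (suc m) ws)

sumFin : (k : ℕ) → (Fin k → ℕ) → ℕ
sumFin k t = sum (map t (allFin k))

-- Row i of S v = v reads sign(bᵢ) P + Σ_{j > i} sign(bⱼ) vⱼ = vᵢ, where P is the sum of the
-- entries of v before i. Subtracting the rows of two consecutive positions leaves a relation
-- between P, vᵢ and vᵢ₊₁ alone: equal entries inside a run of 0s, P = 0 before a step 01,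
-- vᵢ₊₁ = P + vᵢ after a step 10, nothing inside a run of 1s; the last row says that the total
-- sum is 0. Hence every run of 0s is constant and, apart from a single leading 0, vanishes, and
-- the eigenspace is the product over the runs of 1s of the spaces of vectors with zero sum (the
-- first run joined with the leading 0 when s₁ = 1). Such a product has a basis in echelon form
-- with Σ (tᵢ - 1) pivots (one more when s₁ = 1), and an echelon basis computes the dimension
-- because m + 1 vectors of ℚᵐ are always linearly dependent.
module Submission where

open import Defs
open import Data.Bool using (Bool; true; false; if_then_else_)
open import Data.Fin using (Fin; zero; suc; punchIn; _<?_)
open import Data.List using (List; []; _∷_; _++_; length; lookup; replicate; map; allFin; tabulate; concatMap)
open import Data.List.Properties using (length-replicate; length-tabulate; ++-assoc)
open import Data.Nat using (ℕ; zero; suc)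
open import Data.Nat.ListAction using (sum)
open import Data.Product using (∃₂; _×_; _,_; proj₁; proj₂)
open import Function using (_∘_; id)
open import Relation.Binary.PropositionalEquality

module ThresholdSeidelEigenspace where

  open import Algebra.Bundles using (CommutativeRing)
  import Algebra.Properties.Semiring.Sum as SemiringSum
  open import Data.Empty using (⊥-elim)
  open import Data.Fin.Properties using (any?; punchInᵢ≢i; suc-injective; +↔⊎) renaming (_≟_ to _≟ᶠ_)
  open import Data.Maybe using (Maybe; just; nothing)
  open import Data.Nat as ℕ using (s≤s; z≤n)
  open import Data.Product.Function.NonDependent.Propositional using (_×-⇔_)
  open import Data.Rational using (ℚ; 0ℚ; 1ℚ; _+_; _*_; -_; _-_; 1/_; ≢-nonZero; _≤_)
  open import Data.Rational.Properties
    using ( _≟_; +-*-commutativeRing; +-0-group; +-identityʳ; +-identityˡ; +-assoc; +-inverseˡ; +-inverseʳ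
          ; *-zeroˡ; *-zeroʳ; *-identityʳ; *-identityˡ; *-assoc; *-inverseˡ; 1≢0
          ; positive⁻¹; +-mono-<-≤; ≤-refl; <⇒≢; <⇒≤)
  open import Algebra.Properties.Group +-0-group using (x∙y⁻¹≈ε⇒x≈y; x≈y⇒x∙y⁻¹≈ε)
  open import Algebra.Properties.Semiring.Mult (CommutativeRing.semiring +-*-commutativeRing)
    using (×-assoc-*) renaming (_×_ to _×ℚ_)
  open import Data.Sum using (_⊎_; inj₁; inj₂)
  open import Data.Unit using (⊤; tt)
  open import Data.Vec.Functional using (insertAt; tail)
  open import Data.Vec.Functional.Properties using (insertAt-lookup; insertAt-punchIn)
  open import Function.Bundles using (_⇔_; mk⇔; Equivalence; _↔_; Inverse)
  open import Function.Properties.Equivalence using (⇔-setoid) renaming (refl to ⇔-refl; sym to ⇔-sym)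
  open import Function.Properties.Inverse using (↔-sym)
  open import Level using (0ℓ)
  open import Relation.Binary.Definitions using (_Respects_)
  import Relation.Binary.Reasoning.Setoid as SetoidReasoning
  open import Relation.Nullary using (¬_; yes; no; ¬?)
  open import Relation.Nullary.Decidable using (decidable-stable)
  open import Tactic.RingSolver using (solve-∀)
  open import Tactic.RingSolver.Core.AlmostCommutativeRing using (AlmostCommutativeRing; fromCommutativeRing)

  ℚ-ring : AlmostCommutativeRing _ _
  ℚ-ring = fromCommutativeRing +-*-commutativeRing 0≟
    where
    0≟ : ∀ x → Maybe (0ℚ ≡ x)
    0≟ x with 0ℚ ≟ x
    ... | yes p = just p
    ... | no _  = nothing

  module ⇔-Reasoning = SetoidReasoning (⇔-setoid 0ℓ)

  module ℚΣ = SemiringSum (CommutativeRing.semiring +-*-commutativeRing)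

  -- Finite sums

  Σℚ≡sum : ∀ n (f : Fin n → ℚ) → Σℚ n f ≡ ℚΣ.sum f
  Σℚ≡sum zero    f = refl
  Σℚ≡sum (suc n) f = cong (f zero +_) (Σℚ≡sum n (f ∘ suc))

  Σℚ-cong : ∀ n {f g : Fin n → ℚ} → (∀ i → f i ≡ g i) → Σℚ n f ≡ Σℚ n g
  Σℚ-cong zero    f≗g = refl
  Σℚ-cong (suc n) f≗g = cong₂ _+_ (f≗g zero) (Σℚ-cong n (f≗g ∘ suc))

  Σℚ-zero : ∀ n {f : Fin n → ℚ} → (∀ i → f i ≡ 0ℚ) → Σℚ n f ≡ 0ℚ
  Σℚ-zero zero    f≗0 = refl
  Σℚ-zero (suc n) f≗0 = cong₂ _+_ (f≗0 zero) (Σℚ-zero n (f≗0 ∘ suc))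

  Σℚ-distrib-+ : ∀ n (f g : Fin n → ℚ) → Σℚ n (λ i → f i + g i) ≡ Σℚ n f + Σℚ n g
  Σℚ-distrib-+ n f g = begin
    Σℚ n (λ i → f i + g i)    ≡⟨ Σℚ≡sum n _ ⟩
    ℚΣ.sum (λ i → f i + g i)  ≡⟨ ℚΣ.∑-distrib-+ f g ⟩
    ℚΣ.sum f + ℚΣ.sum g       ≡˘⟨ cong₂ _+_ (Σℚ≡sum n f) (Σℚ≡sum n g) ⟩
    Σℚ n f + Σℚ n g           ∎
    where open ≡-Reasoning

  *-distribˡ-Σℚ : ∀ n x (f : Fin n → ℚ) → x * Σℚ n f ≡ Σℚ n (λ i → x * f i)
  *-distribˡ-Σℚ n x f = begin
    x * Σℚ n f                  ≡⟨ cong (x *_) (Σℚ≡sum n f) ⟩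
    x * ℚΣ.sum f                ≡⟨ ℚΣ.*-distribˡ-sum x f ⟩
    ℚΣ.sum (λ i → x * f i)      ≡˘⟨ Σℚ≡sum n _ ⟩
    Σℚ n (λ i → x * f i)        ∎
    where open ≡-Reasoning

  *-distribʳ-Σℚ : ∀ n x (f : Fin n → ℚ) → Σℚ n f * x ≡ Σℚ n (λ i → f i * x)
  *-distribʳ-Σℚ n x f = begin
    Σℚ n f * x                  ≡⟨ cong (_* x) (Σℚ≡sum n f) ⟩
    ℚΣ.sum f * x                ≡⟨ ℚΣ.*-distribʳ-sum x f ⟩
    ℚΣ.sum (λ i → f i * x)      ≡˘⟨ Σℚ≡sum n _ ⟩
    Σℚ n (λ i → f i * x)        ∎
    where open ≡-Reasoning

  Σℚ-comm : ∀ m n (f : Fin m → Fin n → ℚ)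
    → Σℚ m (λ i → Σℚ n (f i)) ≡ Σℚ n (λ j → Σℚ m (λ i → f i j))
  Σℚ-comm m n f = begin
    Σℚ m (λ i → Σℚ n (f i))                  ≡⟨ Σℚ-cong m (λ i → Σℚ≡sum n (f i)) ⟩
    Σℚ m (λ i → ℚΣ.sum (f i))                ≡⟨ Σℚ≡sum m _ ⟩
    ℚΣ.sum (λ i → ℚΣ.sum (f i))              ≡⟨ ℚΣ.∑-comm f ⟩
    ℚΣ.sum (λ j → ℚΣ.sum (λ i → f i j))      ≡˘⟨ Σℚ≡sum n _ ⟩
    Σℚ n (λ j → ℚΣ.sum (λ i → f i j))        ≡˘⟨ Σℚ-cong n (λ j → Σℚ≡sum m (λ i → f i j)) ⟩
    Σℚ n (λ j → Σℚ m (λ i → f i j))          ∎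
    where open ≡-Reasoning

  Σℚ-punchIn : ∀ n (p : Fin (suc n)) (f : Fin (suc n) → ℚ) → Σℚ (suc n) f ≡ f p + Σℚ n (f ∘ punchIn p)
  Σℚ-punchIn n p f = begin
    Σℚ (suc n) f                   ≡⟨ Σℚ≡sum (suc n) f ⟩
    ℚΣ.sum f                       ≡⟨ ℚΣ.sum-remove f ⟩
    f p + ℚΣ.sum (f ∘ punchIn p)   ≡˘⟨ cong (f p +_) (Σℚ≡sum n _) ⟩
    f p + Σℚ n (f ∘ punchIn p)     ∎
    where open ≡-Reasoning

  Σℚ-single : ∀ n (f : Fin n → ℚ) p → (∀ i → i ≢ p → f i ≡ 0ℚ) → Σℚ n f ≡ f p
  Σℚ-single (suc n) f p f≡0 = begin
    Σℚ (suc n) f                ≡⟨ Σℚ-punchIn n p f ⟩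
    f p + Σℚ n (f ∘ punchIn p)  ≡⟨ cong (f p +_) (Σℚ-zero n (λ i → f≡0 (punchIn p i) (punchInᵢ≢i p i))) ⟩
    f p + 0ℚ                    ≡⟨ +-identityʳ (f p) ⟩
    f p                         ∎
    where open ≡-Reasoning

  ×ℚ-zeroʳ : ∀ n → n ×ℚ 0ℚ ≡ 0ℚ
  ×ℚ-zeroʳ zero    = refl
  ×ℚ-zeroʳ (suc n) = trans (+-identityˡ (n ×ℚ 0ℚ)) (×ℚ-zeroʳ n)

  ×-cancel : ∀ n {x} → suc n ×ℚ x ≡ 0ℚ → x ≡ 0ℚ
  ×-cancel n {x} n×x≡0 = begin
    x                    ≡˘⟨ *-identityˡ x ⟩
    1ℚ * x               ≡˘⟨ cong (_* x) (*-inverseˡ c) ⟩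
    1/ c * c * x         ≡⟨ *-assoc (1/ c) c x ⟩
    1/ c * (c * x)       ≡⟨ cong (1/ c *_) c*x≡0 ⟩
    1/ c * 0ℚ            ≡⟨ *-zeroʳ (1/ c) ⟩
    0ℚ                   ∎
    where
    open ≡-Reasoning
    c = suc n ×ℚ 1ℚ
    0≤×1 : ∀ m → 0ℚ ≤ m ×ℚ 1ℚ
    0≤×1 zero    = ≤-refl
    0≤×1 (suc m) = <⇒≤ (+-mono-<-≤ (positive⁻¹ 1ℚ) (0≤×1 m))
    instance
      _ = ≢-nonZero (λ c≡0 → <⇒≢ (+-mono-<-≤ (positive⁻¹ 1ℚ) (0≤×1 n)) (sym c≡0))
    c*x≡0 : c * x ≡ 0ℚ
    c*x≡0 = trans (×-assoc-* (suc n) 1ℚ x) (trans (cong (suc n ×ℚ_) (*-identityˡ x)) n×x≡0)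

  -- Linear dependence

  InEigenspace-Σ : ∀ n d (M : Fin n → Fin n → ℚ) λ′ (ws : Fin d → Fin n → ℚ) (c : Fin d → ℚ)
    → (∀ a → InEigenspace n M λ′ (ws a)) → InEigenspace n M λ′ (λ i → Σℚ d (λ a → c a * ws a i))
  InEigenspace-Σ n d M λ′ ws c ws∈ i = begin
    Σℚ n (λ j → M i j * Σℚ d (λ a → c a * ws a j))
      ≡⟨ Σℚ-cong n (λ j → *-distribˡ-Σℚ d (M i j) _) ⟩
    Σℚ n (λ j → Σℚ d (λ a → M i j * (c a * ws a j)))
      ≡⟨ Σℚ-comm n d _ ⟩
    Σℚ d (λ a → Σℚ n (λ j → M i j * (c a * ws a j)))
      ≡⟨ Σℚ-cong d (λ a → Σℚ-cong n (λ j → swap (M i j) (c a) (ws a j))) ⟩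
    Σℚ d (λ a → Σℚ n (λ j → c a * (M i j * ws a j)))
      ≡˘⟨ Σℚ-cong d (λ a → *-distribˡ-Σℚ n (c a) _) ⟩
    Σℚ d (λ a → c a * Σℚ n (λ j → M i j * ws a j))
      ≡⟨ Σℚ-cong d (λ a → cong (c a *_) (ws∈ a i)) ⟩
    Σℚ d (λ a → c a * (λ′ * ws a i))
      ≡⟨ Σℚ-cong d (λ a → swap (c a) λ′ (ws a i)) ⟩
    Σℚ d (λ a → λ′ * (c a * ws a i))
      ≡˘⟨ *-distribˡ-Σℚ d λ′ _ ⟩
    λ′ * Σℚ d (λ a → c a * ws a i)
      ∎
    where
    open ≡-Reasoning
    swap : ∀ x y z → x * (y * z) ≡ y * (x * z)
    swap = solve-∀ ℚ-ring

  pivotEntry : ∀ {n} (x : Fin (suc n) → ℚ) → ∃₂ λ p (r : Fin n → ℚ) → ∀ a → x (punchIn p a) ≡ r a * x p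
  pivotEntry x with any? (λ a → ¬? (x a ≟ 0ℚ))
  ... | yes (p , xp≢0) = p , (λ a → x (punchIn p a) * 1/ x p) , λ a → sym (begin
    x (punchIn p a) * 1/ x p * x p      ≡⟨ *-assoc (x (punchIn p a)) _ _ ⟩
    x (punchIn p a) * (1/ x p * x p)    ≡⟨ cong (x (punchIn p a) *_) (*-inverseˡ (x p)) ⟩
    x (punchIn p a) * 1ℚ                ≡⟨ *-identityʳ _ ⟩
    x (punchIn p a)                     ∎)
    where
    open ≡-Reasoning
    instance _ = ≢-nonZero xp≢0
  ... | no ¬nonzero = zero , (λ _ → 0ℚ) , λ a → trans (x≡0 (suc a)) (sym (*-zeroˡ (x zero)))
    where
    x≡0 : ∀ a → x a ≡ 0ℚ
    x≡0 a = decidable-stable (x a ≟ 0ℚ) (λ xa≢0 → ¬nonzero (a , xa≢0))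

  Σℚ-eliminate : ∀ n (c r f : Fin n → ℚ) y
    → Σℚ n (λ b → - (c b * r b)) * y + Σℚ n (λ b → c b * f b) ≡ Σℚ n (λ b → c b * (f b - r b * y))
  Σℚ-eliminate n c r f y = begin
    Σℚ n (λ b → - (c b * r b)) * y + Σℚ n (λ b → c b * f b)
      ≡⟨ cong (_+ Σℚ n (λ b → c b * f b)) (*-distribʳ-Σℚ n y _) ⟩
    Σℚ n (λ b → - (c b * r b) * y) + Σℚ n (λ b → c b * f b)   ≡˘⟨ Σℚ-distrib-+ n _ _ ⟩
    Σℚ n (λ b → - (c b * r b) * y + c b * f b)                ≡⟨ Σℚ-cong n (λ b → expand (c b) (r b) (f b) y) ⟩
    Σℚ n (λ b → c b * (f b - r b * y))                        ∎
    where
    open ≡-Reasoning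
    expand : ∀ c r f y → - (c * r) * y + c * f ≡ c * (f - r * y)
    expand = solve-∀ ℚ-ring

  -- One step of Gaussian elimination, clearing the first coordinate with the pivot row p.
  independent-eliminate : ∀ m (u : Fin (suc (suc m)) → Fin (suc m) → ℚ) p (r : Fin (suc m) → ℚ)
    → (∀ a → u (punchIn p a) zero ≡ r a * u p zero)
    → LinearlyIndependent (suc m) (suc (suc m)) u
    → LinearlyIndependent m (suc m) (λ a i → u (punchIn p a) (suc i) - r a * u p (suc i))
  independent-eliminate m u p r pivot indep c′ comb≡0 a = begin
    c′ a              ≡˘⟨ insertAt-punchIn c′ p x a ⟩
    c (punchIn p a)   ≡⟨ indep c c-comb≡0 (punchIn p a) ⟩
    0ℚ                ∎
    where
    open ≡-Reasoning
    x = Σℚ (suc m) (λ b → - (c′ b * r b))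
    c = insertAt c′ p x
    c-comb : ∀ j → Σℚ (suc (suc m)) (λ b → c b * u b j)
                 ≡ Σℚ (suc m) (λ b → c′ b * (u (punchIn p b) j - r b * u p j))
    c-comb j = begin
      Σℚ (suc (suc m)) (λ b → c b * u b j)
        ≡⟨ Σℚ-punchIn (suc m) p (λ b → c b * u b j) ⟩
      c p * u p j + Σℚ (suc m) (λ b → c (punchIn p b) * u (punchIn p b) j)
        ≡⟨ cong₂ (λ y z → y * u p j + z) (insertAt-lookup c′ p x)
                 (Σℚ-cong (suc m) (λ b → cong (_* u (punchIn p b) j) (insertAt-punchIn c′ p x b))) ⟩
      x * u p j + Σℚ (suc m) (λ b → c′ b * u (punchIn p b) j)
        ≡⟨ Σℚ-eliminate (suc m) c′ r (λ b → u (punchIn p b) j) (u p j) ⟩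
      Σℚ (suc m) (λ b → c′ b * (u (punchIn p b) j - r b * u p j))
        ∎
    c-comb≡0 : ∀ j → Σℚ (suc (suc m)) (λ b → c b * u b j) ≡ 0ℚ
    c-comb≡0 zero = trans (c-comb zero)
      (Σℚ-zero (suc m) (λ b → trans (cong (λ y → c′ b * (y - r b * u p zero)) (pivot b))
                                    (trans (cong (c′ b *_) (+-inverseʳ (r b * u p zero))) (*-zeroʳ (c′ b)))))
    c-comb≡0 (suc i) = trans (c-comb (suc i)) (comb≡0 i)

  ¬independent-suc : ∀ m (u : Fin (suc m) → Fin m → ℚ) → ¬ LinearlyIndependent m (suc m) u
  ¬independent-suc zero    u indep = 1≢0 (indep (λ _ → 1ℚ) (λ ()) zero)
  ¬independent-suc (suc m) u indep with pivotEntry (λ a → u a zero)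
  ... | p , r , pivot = ¬independent-suc m (λ a i → u (punchIn p a) (suc i) - r a * u p (suc i))
                                            (independent-eliminate m u p r pivot indep)

  -- Pivot bases

  record PivotBasis {n : ℕ} (V : (Fin n → ℚ) → Set) (I : Set) : Set where
    field
      pivot         : I → Fin n
      basis         : I → Fin n → ℚ
      basis∈        : ∀ a → V (basis a)
      basis-pivot   : ∀ a → basis a (pivot a) ≡ 1ℚ
      basis-pivot-≢ : ∀ {a b} → a ≢ b → basis a (pivot b) ≡ 0ℚ
      zero-on-pivots⇒≡0 : ∀ {v} → V v → (∀ a → v (pivot a) ≡ 0ℚ) → ∀ i → v i ≡ 0ℚ

  eigenvalueMultiplicity : ∀ {n} (M : Fin n → Fin n → ℚ) λ′ {m}
    → PivotBasis (InEigenspace n M λ′) (Fin m) → EigenvalueMultiplicity n M λ′ m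
  eigenvalueMultiplicity {n} M λ′ {m} B =
    (basis , basis∈ , basis-independent) ,
    λ ws ws∈ ws-independent →
      ¬independent-suc m (λ a r → ws a (pivot r)) (pivot-restriction-independent ws ws∈ ws-independent)
    where
    open PivotBasis B
    basis-independent : LinearlyIndependent n m basis
    basis-independent c comb≡0 a = begin
      c a                                        ≡˘⟨ *-identityʳ (c a) ⟩
      c a * 1ℚ                                   ≡˘⟨ cong (c a *_) (basis-pivot a) ⟩
      c a * basis a (pivot a)                    ≡˘⟨ Σℚ-single m (λ b → c b * basis b (pivot a)) a other≡0 ⟩
      Σℚ m (λ b → c b * basis b (pivot a))       ≡⟨ comb≡0 (pivot a) ⟩
      0ℚ                                         ∎
      where
      open ≡-Reasoning
      other≡0 : ∀ b → b ≢ a → c b * basis b (pivot a) ≡ 0ℚ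
      other≡0 b b≢a = trans (cong (c b *_) (basis-pivot-≢ b≢a)) (*-zeroʳ (c b))
    pivot-restriction-independent : ∀ {d} (ws : Fin d → Fin n → ℚ) → (∀ a → InEigenspace n M λ′ (ws a))
      → LinearlyIndependent n d ws → LinearlyIndependent m d (λ a r → ws a (pivot r))
    pivot-restriction-independent {d} ws ws∈ ws-independent c comb≡0 =
      ws-independent c (zero-on-pivots⇒≡0 (InEigenspace-Σ n d M λ′ ws c ws∈) comb≡0)

  reindex : ∀ {n} {V : (Fin n → ℚ) → Set} {I J : Set} → I ↔ J → PivotBasis V I → PivotBasis V J
  reindex {J = J} I↔J B = record
    { pivot             = pivot ∘ from
    ; basis             = basis ∘ from
    ; basis∈            = basis∈ ∘ from
    ; basis-pivot       = basis-pivot ∘ from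
    ; basis-pivot-≢     = λ a≢b → basis-pivot-≢ (from-injective a≢b)
    ; zero-on-pivots⇒≡0 = λ {v} v∈ v≡0 →
        zero-on-pivots⇒≡0 v∈ (λ a → subst (λ a → v (pivot a) ≡ 0ℚ) (strictlyInverseʳ a) (v≡0 (to a)))
    }
    where
    open PivotBasis B
    open Inverse I↔J
    from-injective : ∀ {a b : J} → a ≢ b → from a ≢ from b
    from-injective a≢b fa≡fb = a≢b (trans (sym (strictlyInverseˡ _)) (trans (cong to fa≡fb) (strictlyInverseˡ _)))

  PivotBasis-⇔ : ∀ {n} {V W : (Fin n → ℚ) → Set} {I} → (∀ v → V v ⇔ W v) → PivotBasis V I → PivotBasis W I
  PivotBasis-⇔ V⇔W B = record
    { pivot             = pivot
    ; basis             = basis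
    ; basis∈            = λ a → Equivalence.to (V⇔W (basis a)) (basis∈ a)
    ; basis-pivot       = basis-pivot
    ; basis-pivot-≢     = basis-pivot-≢
    ; zero-on-pivots⇒≡0 = λ {v} v∈W → zero-on-pivots⇒≡0 (Equivalence.from (V⇔W v) v∈W)
    }
    where open PivotBasis B

  module _ {A : Set} where

    leftIndex : (xs ys : List A) → Fin (length xs) → Fin (length (xs ++ ys))
    leftIndex (x ∷ xs) ys zero    = zero
    leftIndex (x ∷ xs) ys (suc i) = suc (leftIndex xs ys i)

    rightIndex : (xs ys : List A) → Fin (length ys) → Fin (length (xs ++ ys))
    rightIndex []       ys j = j
    rightIndex (x ∷ xs) ys j = suc (rightIndex xs ys j)

    glue : (xs ys : List A) → (Fin (length xs) → ℚ) → (Fin (length ys) → ℚ) → Fin (length (xs ++ ys)) → ℚ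
    glue []       ys f g = g
    glue (x ∷ xs) ys f g zero    = f zero
    glue (x ∷ xs) ys f g (suc k) = glue xs ys (f ∘ suc) g k

    glue-leftIndex : ∀ xs ys f g i → glue xs ys f g (leftIndex xs ys i) ≡ f i
    glue-leftIndex (x ∷ xs) ys f g zero    = refl
    glue-leftIndex (x ∷ xs) ys f g (suc i) = glue-leftIndex xs ys (f ∘ suc) g i

    glue-rightIndex : ∀ xs ys f g j → glue xs ys f g (rightIndex xs ys j) ≡ g j
    glue-rightIndex []       ys f g j = refl
    glue-rightIndex (x ∷ xs) ys f g j = glue-rightIndex xs ys (f ∘ suc) g j

    ++-≡0 : ∀ xs ys (v : Fin (length (xs ++ ys)) → ℚ)
      → (∀ i → v (leftIndex xs ys i) ≡ 0ℚ) → (∀ j → v (rightIndex xs ys j) ≡ 0ℚ) → ∀ k → v k ≡ 0ℚ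
    ++-≡0 []       ys v _    right≡0 k       = right≡0 k
    ++-≡0 (x ∷ xs) ys v left≡0 right≡0 zero    = left≡0 zero
    ++-≡0 (x ∷ xs) ys v left≡0 right≡0 (suc k) = ++-≡0 xs ys (v ∘ suc) (left≡0 ∘ suc) right≡0 k

    Product : (xs ys : List A) → ((Fin (length xs) → ℚ) → Set) → ((Fin (length ys) → ℚ) → Set)
            → (Fin (length (xs ++ ys)) → ℚ) → Set
    Product xs ys V W v = V (v ∘ leftIndex xs ys) × W (v ∘ rightIndex xs ys)

    Product-respects : ∀ xs ys {V W} → V Respects _≗_ → W Respects _≗_ → Product xs ys V W Respects _≗_
    Product-respects xs ys V-resp W-resp v≗w (v∈ , w∈) =
      V-resp (v≗w ∘ leftIndex xs ys) v∈ , W-resp (v≗w ∘ rightIndex xs ys) w∈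

    Product-pivotBasis : ∀ xs ys {V W m n} → V Respects _≗_ → W Respects _≗_ → V (λ _ → 0ℚ) → W (λ _ → 0ℚ)
      → PivotBasis V (Fin m) → PivotBasis W (Fin n) → PivotBasis (Product xs ys V W) (Fin (m ℕ.+ n))
    Product-pivotBasis xs ys {V} {W} V-resp W-resp 0∈V 0∈W BV BW = reindex (↔-sym +↔⊎) (record
      { pivot             = pivot
      ; basis             = basis
      ; basis∈            = basis∈
      ; basis-pivot       = basis-pivot
      ; basis-pivot-≢     = basis-pivot-≢
      ; zero-on-pivots⇒≡0 = zero-on-pivots⇒≡0
      })
      where
      module V = PivotBasis BV
      module W = PivotBasis BW
      0ᵛ : ∀ {k} → Fin k → ℚ
      0ᵛ _ = 0ℚ
      pivot : _ ⊎ _ → Fin (length (xs ++ ys))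
      pivot (inj₁ a) = leftIndex xs ys (V.pivot a)
      pivot (inj₂ b) = rightIndex xs ys (W.pivot b)
      basis : _ ⊎ _ → Fin (length (xs ++ ys)) → ℚ
      basis (inj₁ a) = glue xs ys (V.basis a) 0ᵛ
      basis (inj₂ b) = glue xs ys 0ᵛ (W.basis b)
      basis∈ : ∀ c → Product xs ys V W (basis c)
      basis∈ (inj₁ a) = V-resp (sym ∘ glue-leftIndex xs ys _ _) (V.basis∈ a)
                      , W-resp (sym ∘ glue-rightIndex xs ys _ _) 0∈W
      basis∈ (inj₂ b) = V-resp (sym ∘ glue-leftIndex xs ys _ _) 0∈V
                      , W-resp (sym ∘ glue-rightIndex xs ys _ _) (W.basis∈ b)
      basis-pivot : ∀ c → basis c (pivot c) ≡ 1ℚ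
      basis-pivot (inj₁ a) = trans (glue-leftIndex xs ys _ _ _) (V.basis-pivot a)
      basis-pivot (inj₂ b) = trans (glue-rightIndex xs ys _ _ _) (W.basis-pivot b)
      basis-pivot-≢ : ∀ {c d} → c ≢ d → basis c (pivot d) ≡ 0ℚ
      basis-pivot-≢ {inj₁ a} {inj₁ a′} c≢d =
        trans (glue-leftIndex xs ys _ _ _) (V.basis-pivot-≢ (c≢d ∘ cong inj₁))
      basis-pivot-≢ {inj₁ a} {inj₂ b′} c≢d = glue-rightIndex xs ys _ _ _
      basis-pivot-≢ {inj₂ b} {inj₁ a′} c≢d = glue-leftIndex xs ys _ _ _
      basis-pivot-≢ {inj₂ b} {inj₂ b′} c≢d =
        trans (glue-rightIndex xs ys _ _ _) (W.basis-pivot-≢ (c≢d ∘ cong inj₂))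
      zero-on-pivots⇒≡0 : ∀ {v} → Product xs ys V W v → (∀ c → v (pivot c) ≡ 0ℚ) → ∀ k → v k ≡ 0ℚ
      zero-on-pivots⇒≡0 {v} (v∈V , v∈W) v≡0 = ++-≡0 xs ys v
        (V.zero-on-pivots⇒≡0 v∈V (v≡0 ∘ inj₁)) (W.zero-on-pivots⇒≡0 v∈W (v≡0 ∘ inj₂))

  Vanishing : ∀ {n} → (Fin n → ℚ) → Set
  Vanishing v = ∀ i → v i ≡ 0ℚ

  Vanishing-respects : ∀ {n} → Vanishing {n} Respects _≗_
  Vanishing-respects v≗w v≡0 i = trans (sym (v≗w i)) (v≡0 i)

  Vanishing-pivotBasis : ∀ {n} → PivotBasis (Vanishing {n}) (Fin 0)
  Vanishing-pivotBasis = record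
    { pivot = λ () ; basis = λ () ; basis∈ = λ () ; basis-pivot = λ ()
    ; basis-pivot-≢ = λ { {()} } ; zero-on-pivots⇒≡0 = λ v∈ _ → v∈ }

  SumZero : ∀ {n} → (Fin n → ℚ) → Set
  SumZero {n} v = Σℚ n v ≡ 0ℚ

  SumZero-respects : ∀ {n} → SumZero {n} Respects _≗_
  SumZero-respects {n} v≗w Σv≡0 = trans (sym (Σℚ-cong n v≗w)) Σv≡0

  0∈SumZero : ∀ n → SumZero {n} (λ _ → 0ℚ)
  0∈SumZero n = Σℚ-zero n (λ _ → refl)

  unitVector : ∀ {n} → Fin n → Fin n → ℚ
  unitVector a i with a ≟ᶠ i
  ... | yes _ = 1ℚ
  ... | no _  = 0ℚ

  unitVector-diag : ∀ {n} (a : Fin n) → unitVector a a ≡ 1ℚ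
  unitVector-diag a with a ≟ᶠ a
  ... | yes _  = refl
  ... | no a≢a = ⊥-elim (a≢a refl)

  unitVector-≢ : ∀ {n} {a b : Fin n} → a ≢ b → unitVector a b ≡ 0ℚ
  unitVector-≢ {a = a} {b} a≢b with a ≟ᶠ b
  ... | yes a≡b = ⊥-elim (a≢b a≡b)
  ... | no _    = refl

  Σℚ-unitVector : ∀ n (a : Fin n) → Σℚ n (unitVector a) ≡ 1ℚ
  Σℚ-unitVector n a =
    trans (Σℚ-single n (unitVector a) a (λ i i≢a → unitVector-≢ (i≢a ∘ sym))) (unitVector-diag a)

  SumZero-pivotBasis : ∀ n → PivotBasis (SumZero {suc n}) (Fin n)
  SumZero-pivotBasis n = record
    { pivot             = suc
    ; basis             = basis
    ; basis∈            = λ a → trans (cong (- 1ℚ +_) (Σℚ-unitVector n a)) (+-inverseˡ 1ℚ)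
    ; basis-pivot       = unitVector-diag
    ; basis-pivot-≢     = unitVector-≢
    ; zero-on-pivots⇒≡0 = zero-on-pivots⇒≡0
    }
    where
    basis : Fin n → Fin (suc n) → ℚ
    basis a zero    = - 1ℚ
    basis a (suc i) = unitVector a i
    zero-on-pivots⇒≡0 : ∀ {v} → SumZero v → (∀ a → v (suc a) ≡ 0ℚ) → ∀ i → v i ≡ 0ℚ
    zero-on-pivots⇒≡0 {v} Σv≡0 v≡0 zero = begin
      v zero                          ≡˘⟨ +-identityʳ (v zero) ⟩
      v zero + 0ℚ                     ≡˘⟨ cong (v zero +_) (Σℚ-zero n v≡0) ⟩
      v zero + Σℚ n (v ∘ suc)         ≡⟨ Σv≡0 ⟩
      0ℚ                              ∎
      where open ≡-Reasoning
    zero-on-pivots⇒≡0 Σv≡0 v≡0 (suc i) = v≡0 i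

  -- The eigenvalue 1 of the Seidel matrix of a threshold graph

  sign : Bool → ℚ
  sign b = if b then - 1ℚ else 1ℚ

  module _ (n : ℕ) (α : Fin (suc n) → Bool) where

    private
      S  = seidel (suc n) (thrAdj (suc n) α)
      S′ = seidel n (thrAdj n (α ∘ suc))

    thrAdj-suc-suc : ∀ i j → thrAdj (suc n) α (suc i) (suc j) ≡ thrAdj n (α ∘ suc) i j
    thrAdj-suc-suc i j with suc i ≟ᶠ suc j | i ≟ᶠ j
    ... | yes _     | yes _   = refl
    ... | yes si≡sj | no i≢j  = ⊥-elim (i≢j (suc-injective si≡sj))
    ... | no si≢sj  | yes i≡j = ⊥-elim (si≢sj (cong suc i≡j))
    ... | no _      | no _ with _<?_ {suc n} {suc n} (suc i) (suc j) | _<?_ {n} {n} i j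
    ...   | yes _         | yes _   = refl
    ...   | no _          | no _    = refl
    ...   | yes (s≤s i<j) | no i≮j  = ⊥-elim (i≮j i<j)
    ...   | no si≮sj      | yes i<j = ⊥-elim (si≮sj (s≤s i<j))

    thrSeidel-suc-suc : ∀ i j → S (suc i) (suc j) ≡ S′ i j
    thrSeidel-suc-suc i j with suc i ≟ᶠ suc j | i ≟ᶠ j
    ... | yes _     | yes _   = refl
    ... | yes si≡sj | no i≢j  = ⊥-elim (i≢j (suc-injective si≡sj))
    ... | no si≢sj  | yes i≡j = ⊥-elim (si≢sj (cong suc i≡j))
    ... | no _      | no _ rewrite thrAdj-suc-suc i j = refl

    thrSeidel-zero-suc : ∀ j → S zero (suc j) ≡ sign (α (suc j))
    thrSeidel-zero-suc j with _<?_ {suc n} {suc n} zero (suc j)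
    ... | yes _  = refl
    ... | no 0≮j = ⊥-elim (0≮j (s≤s z≤n))

    thrSeidel-suc-zero : ∀ i → S (suc i) zero ≡ sign (α (suc i))
    thrSeidel-suc-zero i with _<?_ {suc n} {suc n} (suc i) zero
    ... | no _ = refl

  -- The rows of S v = v indexed by a final segment b of the string, when the entries of v
  -- before that segment sum to P: each earlier vertex j contributes sign(bᵢ) vⱼ to row i.
  SuffixEquations : (b : List Bool) → ℚ → (Fin (length b) → ℚ) → Set
  SuffixEquations b P v = ∀ i → sign (lookup b i) * P + Σℚ (length b) (λ j → thresholdSeidel b i j * v j) ≡ v i

  signedSum : (b : List Bool) → (Fin (length b) → ℚ) → ℚ
  signedSum b v = Σℚ (length b) (λ j → sign (lookup b j) * v j)

  SuffixEquations-∷ : ∀ a bs P (v : Fin (suc (length bs)) → ℚ)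
    → SuffixEquations (a ∷ bs) P v
      ⇔ ((sign a * P + signedSum bs (v ∘ suc) ≡ v zero) × SuffixEquations bs (P + v zero) (v ∘ suc))
  SuffixEquations-∷ a bs P v = mk⇔
    (λ eqs → trans (sym row-zero) (eqs zero) , λ i → trans (sym (row-suc i)) (eqs (suc i)))
    (λ { (eq₀ , eqs) zero → trans row-zero eq₀ ; (eq₀ , eqs) (suc i) → trans (row-suc i) (eqs i) })
    where
    open ≡-Reasoning
    n = length bs
    S = thresholdSeidel (a ∷ bs)
    row : Fin (suc n) → ℚ
    row i = sign (lookup (a ∷ bs) i) * P + Σℚ (suc n) (λ j → S i j * v j)
    row-zero : row zero ≡ sign a * P + signedSum bs (v ∘ suc)
    row-zero = cong (sign a * P +_) (begin
      0ℚ * v zero + Σ₀        ≡⟨ cong (_+ Σ₀) (*-zeroˡ (v zero)) ⟩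
      0ℚ + Σ₀                 ≡⟨ +-identityˡ Σ₀ ⟩
      Σ₀                      ≡⟨ Σℚ-cong n (λ j → cong (_* v (suc j)) (thrSeidel-zero-suc n (lookup (a ∷ bs)) j)) ⟩
      signedSum bs (v ∘ suc)  ∎)
      where Σ₀ = Σℚ n (λ j → S zero (suc j) * v (suc j))
    row-suc : ∀ i → row (suc i) ≡ sign (lookup bs i) * (P + v zero) + Σℚ n (λ j → thresholdSeidel bs i j * v (suc j))
    row-suc i = begin
      σ * P + (S (suc i) zero * v zero + Σℚ n (λ j → S (suc i) (suc j) * v (suc j)))
        ≡⟨ cong₂ (λ x y → σ * P + (x * v zero + y)) (thrSeidel-suc-zero n (lookup (a ∷ bs)) i)
                 (Σℚ-cong n (λ j → cong (_* v (suc j)) (thrSeidel-suc-suc n (lookup (a ∷ bs)) i j))) ⟩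
      σ * P + (σ * v zero + Σℚ n (λ j → thresholdSeidel bs i j * v (suc j)))
        ≡⟨ regroup σ P (v zero) _ ⟩
      σ * (P + v zero) + Σℚ n (λ j → thresholdSeidel bs i j * v (suc j)) ∎
      where
      σ = sign (lookup bs i)
      regroup : ∀ σ P x y → σ * P + (σ * x + y) ≡ σ * (P + x) + y
      regroup = solve-∀ ℚ-ring

  -- Compatibility of the equations at consecutive entries x, y labelled a, a′, when the
  -- entries before x sum to P.
  Step : Bool → Bool → ℚ → ℚ → ℚ → Set
  Step false false P x y = x ≡ y
  Step false true  P x y = P ≡ 0ℚ
  Step true  false P x y = P + x ≡ y
  Step true  true  P x y = ⊤

  LocalConditions : (b : List Bool) → ℚ → (Fin (length b) → ℚ) → Set
  LocalConditions []           P v = ⊤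
  LocalConditions (a ∷ [])     P v = sign a * P ≡ v zero
  LocalConditions (a ∷ a′ ∷ b) P v = Step a a′ P (v zero) (v (suc zero)) × LocalConditions (a′ ∷ b) (P + v zero) (v ∘ suc)

  -- Half the difference of the two consecutive equations.
  defect : Bool → Bool → ℚ → ℚ → ℚ → ℚ
  defect false false P x y = y - x
  defect false true  P x y = P
  defect true  false P x y = y - (P + x)
  defect true  true  P x y = 0ℚ

  defect≡0⇔Step : ∀ a a′ P x y → (defect a a′ P x y ≡ 0ℚ) ⇔ Step a a′ P x y
  defect≡0⇔Step false false P x y = mk⇔ (sym ∘ x∙y⁻¹≈ε⇒x≈y y x) (x≈y⇒x∙y⁻¹≈ε ∘ sym)
  defect≡0⇔Step false true  P x y = mk⇔ id id
  defect≡0⇔Step true  false P x y = mk⇔ (sym ∘ x∙y⁻¹≈ε⇒x≈y y (P + x)) (x≈y⇒x∙y⁻¹≈ε ∘ sym)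
  defect≡0⇔Step true  true  P x y = mk⇔ (λ _ → tt) (λ _ → refl)

  step-identity : ∀ a a′ P x y → sign a * P + (sign a′ * y + (y - sign a′ * (P + x))) - x ≡ 2 ×ℚ defect a a′ P x y
  step-identity false false P x y = identity P x y
    where
    identity : ∀ P x y → 1ℚ * P + (1ℚ * y + (y - 1ℚ * (P + x))) - x ≡ (y - x) + ((y - x) + 0ℚ)
    identity = solve-∀ ℚ-ring
  step-identity false true P x y = identity P x y
    where
    identity : ∀ P x y → 1ℚ * P + (- 1ℚ * y + (y - - 1ℚ * (P + x))) - x ≡ P + (P + 0ℚ)
    identity = solve-∀ ℚ-ring
  step-identity true false P x y = identity P x y
    where
    identity : ∀ P x y → - 1ℚ * P + (1ℚ * y + (y - 1ℚ * (P + x))) - x ≡ (y - (P + x)) + ((y - (P + x)) + 0ℚ)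
    identity = solve-∀ ℚ-ring
  step-identity true true P x y = identity P x y
    where
    identity : ∀ P x y → - 1ℚ * P + (- 1ℚ * y + (y - - 1ℚ * (P + x))) - x ≡ 0ℚ
    identity = solve-∀ ℚ-ring

  step⇔ : ∀ a a′ P x y w → sign a′ * (P + x) + w ≡ y
    → (sign a * P + (sign a′ * y + w) ≡ x) ⇔ Step a a′ P x y
  step⇔ a a′ P x y w eq₁ = mk⇔
    (λ eq₀ → Equivalence.to defect⇔ (×-cancel 1 (trans (sym difference) (x≈y⇒x∙y⁻¹≈ε eq₀))))
    (λ step → x∙y⁻¹≈ε⇒x≈y _ x (trans difference (cong (2 ×ℚ_) (Equivalence.from defect⇔ step))))
    where
    defect⇔ = defect≡0⇔Step a a′ P x y
    σ = sign a′ * (P + x)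
    w≡ : w ≡ y - σ
    w≡ = trans (sym (cancel σ w)) (cong (_- σ) eq₁)
      where
      cancel : ∀ σ w → σ + w - σ ≡ w
      cancel = solve-∀ ℚ-ring
    difference : sign a * P + (sign a′ * y + w) - x ≡ 2 ×ℚ defect a a′ P x y
    difference = trans (cong (λ w → sign a * P + (sign a′ * y + w) - x) w≡) (step-identity a a′ P x y)

  SuffixEquations⇔LocalConditions-∷∷ : ∀ a a′ b P (v : Fin (suc (suc (length b))) → ℚ)
    → SuffixEquations (a′ ∷ b) (P + v zero) (v ∘ suc) ⇔ LocalConditions (a′ ∷ b) (P + v zero) (v ∘ suc)
    → SuffixEquations (a ∷ a′ ∷ b) P v ⇔ LocalConditions (a ∷ a′ ∷ b) P v
  SuffixEquations⇔LocalConditions-∷∷ a a′ b P v rest⇔ = mk⇔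
    (λ eqs → let split = Equivalence.to head⇔ eqs
             in Equivalence.to (step⇔′ (proj₂ split)) (proj₁ split) , Equivalence.to rest⇔ (proj₂ split))
    (λ conds → let eqs′ = Equivalence.from rest⇔ (proj₂ conds)
               in Equivalence.from head⇔ (Equivalence.from (step⇔′ eqs′) (proj₁ conds) , eqs′))
    where
    head⇔ = SuffixEquations-∷ a (a′ ∷ b) P v
    step⇔′ : SuffixEquations (a′ ∷ b) (P + v zero) (v ∘ suc)
           → (sign a * P + signedSum (a′ ∷ b) (v ∘ suc) ≡ v zero) ⇔ Step a a′ P (v zero) (v (suc zero))
    step⇔′ eqs′ = step⇔ a a′ P (v zero) (v (suc zero)) (signedSum b (λ j → v (suc (suc j))))
      (proj₁ (Equivalence.to (SuffixEquations-∷ a′ b (P + v zero) (v ∘ suc)) eqs′))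

  SuffixEquations⇔LocalConditions : ∀ b P v → SuffixEquations b P v ⇔ LocalConditions b P v
  SuffixEquations⇔LocalConditions []           P v = mk⇔ (λ _ → tt) (λ _ ())
  SuffixEquations⇔LocalConditions (a ∷ [])     P v = mk⇔
    (λ eqs → trans (sym (+-identityʳ _)) (proj₁ (Equivalence.to (SuffixEquations-∷ a [] P v) eqs)))
    (λ eq → Equivalence.from (SuffixEquations-∷ a [] P v) (trans (+-identityʳ _) eq , λ ()))
  SuffixEquations⇔LocalConditions (a ∷ a′ ∷ b) P v = SuffixEquations⇔LocalConditions-∷∷ a a′ b P v
    (SuffixEquations⇔LocalConditions (a′ ∷ b) (P + v zero) (v ∘ suc))

  InEigenspace₁ : (b : List Bool) → (Fin (length b) → ℚ) → Set
  InEigenspace₁ b = InEigenspace (length b) (thresholdSeidel b) 1ℚ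

  InEigenspace₁⇔LocalConditions : ∀ b v → InEigenspace₁ b v ⇔ LocalConditions b 0ℚ v
  InEigenspace₁⇔LocalConditions b v = mk⇔
    (λ eig → Equivalence.to conditions⇔ (λ i → trans (row≡ i) (trans (eig i) (*-identityˡ (v i)))))
    (λ conds i → trans (sym (row≡ i)) (trans (Equivalence.from conditions⇔ conds i) (sym (*-identityˡ (v i)))))
    where
    conditions⇔ = SuffixEquations⇔LocalConditions b 0ℚ v
    Sv : Fin (length b) → ℚ
    Sv i = Σℚ (length b) (λ j → thresholdSeidel b i j * v j)
    row≡ : ∀ i → sign (lookup b i) * 0ℚ + Sv i ≡ Sv i
    row≡ i = trans (cong (_+ Sv i) (*-zeroʳ (sign (lookup b i)))) (+-identityˡ (Sv i))

  -- Block strings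

  -- Conditions on the segment b following an entry labelled 1, the entries before b summing to Q.
  AfterOne : (b : List Bool) → ℚ → (Fin (length b) → ℚ) → Set
  AfterOne []          Q v = Q ≡ 0ℚ
  AfterOne (false ∷ b) Q v = Q ≡ v zero × LocalConditions (false ∷ b) Q v
  AfterOne (true ∷ b)  Q v = LocalConditions (true ∷ b) Q v

  LocalConditions-true∷ : ∀ b P v → LocalConditions (true ∷ b) P v ⇔ AfterOne b (P + v zero) (v ∘ suc)
  LocalConditions-true∷ []          P v = mk⇔
    (λ -P≡v₀ → trans (cong (P +_) (sym -P≡v₀)) (P-P≡0 P))
    (λ P+v₀≡0 → trans (-P≡-[P+x]+x P (v zero))
                      (trans (cong (λ y → - y + v zero) P+v₀≡0) (+-identityˡ (v zero))))
    where
    P-P≡0 : ∀ P → P + - 1ℚ * P ≡ 0ℚ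
    P-P≡0 = solve-∀ ℚ-ring
    -P≡-[P+x]+x : ∀ P x → - 1ℚ * P ≡ - (P + x) + x
    -P≡-[P+x]+x = solve-∀ ℚ-ring
  LocalConditions-true∷ (false ∷ b) P v = mk⇔ id id
  LocalConditions-true∷ (true ∷ b)  P v = mk⇔ proj₂ (tt ,_)

  LocalConditions-ones : ∀ t b P (v : Fin (length (replicate (suc t) true ++ b)) → ℚ)
    → let os = replicate (suc t) true in
      LocalConditions (os ++ b) P v ⇔ AfterOne b (P + Σℚ (length os) (v ∘ leftIndex os b)) (v ∘ rightIndex os b)
  LocalConditions-ones zero    b P v = begin
    LocalConditions (true ∷ b) P v
      ≈⟨ LocalConditions-true∷ b P v ⟩
    AfterOne b (P + v zero) (v ∘ suc)
      ≡⟨ cong (λ Q → AfterOne b (P + Q) (v ∘ suc)) (sym (+-identityʳ (v zero))) ⟩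
    AfterOne b (P + (v zero + 0ℚ)) (v ∘ suc)
      ∎
    where open ⇔-Reasoning
  LocalConditions-ones (suc t) b P v = begin
    LocalConditions (true ∷ os ++ b) P v
      ≈⟨ LocalConditions-true∷ (os ++ b) P v ⟩
    LocalConditions (os ++ b) (P + v zero) (v ∘ suc)
      ≈⟨ LocalConditions-ones t b (P + v zero) (v ∘ suc) ⟩
    AfterOne b (P + v zero + Σℚ (length os) (tail v ∘ leftIndex os b)) (tail v ∘ rightIndex os b)
      ≡⟨ cong (λ Q → AfterOne b Q (tail v ∘ rightIndex os b)) (+-assoc P (v zero) _) ⟩
    AfterOne b (P + (v zero + Σℚ (length os) (tail v ∘ leftIndex os b))) (tail v ∘ rightIndex os b) ∎
    where
    open ⇔-Reasoning
    os = replicate (suc t) true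

  Constant : ∀ {n} → (Fin (suc n) → ℚ) → Set
  Constant u = ∀ i → u i ≡ u zero

  LocalConditions-zeros : ∀ s X P (v : Fin (length (replicate (suc s) false ++ true ∷ X)) → ℚ)
    → let zs = replicate (suc s) false in
      LocalConditions (zs ++ true ∷ X) P v
      ⇔ (Constant (v ∘ leftIndex zs (true ∷ X)) × P + s ×ℚ v zero ≡ 0ℚ
         × LocalConditions (true ∷ X) (P + suc s ×ℚ v zero) (v ∘ rightIndex zs (true ∷ X)))
  LocalConditions-zeros zero X P v = mk⇔
    (λ conds → (λ { zero → refl }) , trans (+-identityʳ P) (proj₁ conds)
             , subst (λ Q → LocalConditions (true ∷ X) (P + Q) (tail v)) (sym (+-identityʳ (v zero))) (proj₂ conds))
    (λ conds → trans (sym (+-identityʳ P)) (proj₁ (proj₂ conds))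
             , subst (λ Q → LocalConditions (true ∷ X) (P + Q) (tail v)) (+-identityʳ (v zero)) (proj₂ (proj₂ conds)))
  LocalConditions-zeros (suc s) X P v = LocalConditions-zeros-step s X P v (LocalConditions-zeros s X (P + v zero) (tail v))
    where
    LocalConditions-zeros-step : ∀ s X P (v : Fin (suc (length (replicate (suc s) false ++ true ∷ X))) → ℚ)
      → let zs = replicate (suc s) false in
      LocalConditions (zs ++ true ∷ X) (P + v zero) (tail v)
        ⇔ (Constant (tail v ∘ leftIndex zs (true ∷ X)) × P + v zero + s ×ℚ v (suc zero) ≡ 0ℚ
           × LocalConditions (true ∷ X) (P + v zero + suc s ×ℚ v (suc zero)) (tail v ∘ rightIndex zs (true ∷ X)))
      → LocalConditions (false ∷ zs ++ true ∷ X) P v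
        ⇔ (Constant (v ∘ leftIndex (false ∷ zs) (true ∷ X)) × P + suc s ×ℚ v zero ≡ 0ℚ
           × LocalConditions (true ∷ X) (P + suc (suc s) ×ℚ v zero) (v ∘ rightIndex (false ∷ zs) (true ∷ X)))
    LocalConditions-zeros-step s X P v rest⇔ = mk⇔
      (λ conds → let e = proj₁ conds ; c , z , lc = Equivalence.to rest⇔ (proj₂ conds) in
        (λ { zero → refl ; (suc i) → trans (c i) (sym e) }) , trans (sym (shift e s)) z
        , subst (λ Q → LocalConditions (true ∷ X) Q _) (shift e (suc s)) lc)
      (λ conds → let c , z , lc = conds ; e = sym (c (suc zero)) in
        e , Equivalence.from rest⇔ ((λ i → trans (c (suc i)) e) , trans (shift e s) z
        , subst (λ Q → LocalConditions (true ∷ X) Q _) (sym (shift e (suc s))) lc))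
      where
      shift : v zero ≡ v (suc zero) → ∀ n → P + v zero + n ×ℚ v (suc zero) ≡ P + suc n ×ℚ v zero
      shift e n = trans (cong (λ y → P + v zero + n ×ℚ y) (sym e)) (+-assoc P (v zero) (n ×ℚ v zero))

  Constant⇔Vanishing : ∀ m {k} (z : Fin (suc k) → ℚ) (C : ℚ → Set)
    → (Constant z × suc m ×ℚ z zero ≡ 0ℚ × C (suc (suc m) ×ℚ z zero)) ⇔ (Vanishing z × C 0ℚ)
  Constant⇔Vanishing m z C = mk⇔
    (λ conds → let c , e , Cz = conds ; z₀≡0 = ×-cancel m e in
      (λ i → trans (c i) z₀≡0) , subst C (n×z₀≡0 (suc (suc m)) z₀≡0) Cz)
    (λ conds → let z≡0 , C0 = conds in
      (λ i → trans (z≡0 i) (sym (z≡0 zero))) , n×z₀≡0 (suc m) (z≡0 zero)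
      , subst C (sym (n×z₀≡0 (suc (suc m)) (z≡0 zero))) C0)
    where
    n×z₀≡0 : ∀ n → z zero ≡ 0ℚ → n ×ℚ z zero ≡ 0ℚ
    n×z₀≡0 n z₀≡0 = trans (cong (n ×ℚ_) z₀≡0) (×ℚ-zeroʳ n)

  blockString : List (ℕ × ℕ) → List Bool
  blockString []             = []
  blockString ((s , t) ∷ ps) = replicate (suc s) false ++ replicate (suc t) true ++ blockString ps

  excess : List (ℕ × ℕ) → ℕ
  excess ps = sum (map proj₂ ps)

  Balanced : (ps : List (ℕ × ℕ)) → (Fin (length (blockString ps)) → ℚ) → Set
  Balanced []             = Vanishing
  Balanced ((s , t) ∷ ps) = Product (replicate (suc s) false) (replicate (suc t) true ++ blockString ps) Vanishing
                              (Product (replicate (suc t) true) (blockString ps) SumZero (Balanced ps))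

  SumZero×Balanced : (xs : List Bool) (ps : List (ℕ × ℕ)) → (Fin (length (xs ++ blockString ps)) → ℚ) → Set
  SumZero×Balanced xs ps = Product xs (blockString ps) SumZero (Balanced ps)

  ≡×-subst : ∀ {x y : ℚ} (A : ℚ → Set) → (x ≡ y × A x) ⇔ (x ≡ y × A y)
  ≡×-subst A = mk⇔ (λ (x≡y , Ax) → x≡y , subst A x≡y Ax) (λ (x≡y , Ay) → x≡y , subst A (sym x≡y) Ay)

  AfterOne⇔Balanced : ∀ ps Q u → AfterOne (blockString ps) Q u ⇔ (Q ≡ 0ℚ × Balanced ps u)
  LocalConditions⇔Balanced-ones : ∀ t ps u → let os = replicate (suc t) true in
    LocalConditions (os ++ blockString ps) 0ℚ u ⇔ SumZero×Balanced os ps u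

  LocalConditions⇔Balanced-ones t ps u = begin
    LocalConditions (os ++ rest) 0ℚ u                    ≈⟨ LocalConditions-ones t rest 0ℚ u ⟩
    AfterOne rest (0ℚ + Σ) r                             ≡⟨ cong (λ Q → AfterOne rest Q r) (+-identityˡ Σ) ⟩
    AfterOne rest Σ r                                    ≈⟨ AfterOne⇔Balanced ps Σ r ⟩
    (Σ ≡ 0ℚ × Balanced ps r)                             ∎
    where
    open ⇔-Reasoning
    os = replicate (suc t) true
    rest = blockString ps
    Σ = Σℚ (length os) (u ∘ leftIndex os rest)
    r = u ∘ rightIndex os rest

  AfterOne⇔Balanced []             Q u = mk⇔ (_, λ ()) proj₁
  AfterOne⇔Balanced ((s , t) ∷ ps) Q u = begin
    (Q ≡ u zero × LocalConditions (zs ++ os ++ rest) Q u)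
      ≈⟨ ⇔-refl ×-⇔ LocalConditions-zeros s (replicate t true ++ rest) Q u ⟩
    (Q ≡ u zero × (Constant z × Q + s ×ℚ u zero ≡ 0ℚ × LocalConditions (os ++ rest) (Q + suc s ×ℚ u zero) r))
      ≈⟨ ≡×-subst (λ Q → Constant z × Q + s ×ℚ u zero ≡ 0ℚ
                          × LocalConditions (os ++ rest) (Q + suc s ×ℚ u zero) r) ⟩
    (Q ≡ u zero × (Constant z × suc s ×ℚ u zero ≡ 0ℚ × LocalConditions (os ++ rest) (suc (suc s) ×ℚ u zero) r))
      ≈⟨ ⇔-refl ×-⇔ Constant⇔Vanishing s z (λ P → LocalConditions (os ++ rest) P r) ⟩
    (Q ≡ u zero × (Vanishing z × LocalConditions (os ++ rest) 0ℚ r))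
      ≈⟨ Q≡u₀⇔Q≡0 ⟩
    (Q ≡ 0ℚ × (Vanishing z × LocalConditions (os ++ rest) 0ℚ r))
      ≈⟨ ⇔-refl ×-⇔ (⇔-refl ×-⇔ LocalConditions⇔Balanced-ones t ps r) ⟩
    (Q ≡ 0ℚ × Balanced ((s , t) ∷ ps) u) ∎
    where
    open ⇔-Reasoning
    zs = replicate (suc s) false
    os = replicate (suc t) true
    rest = blockString ps
    z = u ∘ leftIndex zs (os ++ rest)
    r = u ∘ rightIndex zs (os ++ rest)
    Q≡u₀⇔Q≡0 : ∀ {B : Set} → (Q ≡ u zero × (Vanishing z × B)) ⇔ (Q ≡ 0ℚ × (Vanishing z × B))
    Q≡u₀⇔Q≡0 = mk⇔ (λ (Q≡u₀ , z≡0 , b) → trans Q≡u₀ (z≡0 zero) , z≡0 , b)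
                   (λ (Q≡0 , z≡0 , b) → trans Q≡0 (sym (z≡0 zero)) , z≡0 , b)

  InEigenspace₁⇔Balanced : ∀ s t ps v
    → InEigenspace₁ (blockString ((suc s , t) ∷ ps)) v ⇔ Balanced ((suc s , t) ∷ ps) v
  InEigenspace₁⇔Balanced s t ps v = begin
    InEigenspace₁ (zs ++ os ++ rest) v
      ≈⟨ InEigenspace₁⇔LocalConditions (zs ++ os ++ rest) v ⟩
    LocalConditions (zs ++ os ++ rest) 0ℚ v
      ≈⟨ LocalConditions-zeros (suc s) (replicate t true ++ rest) 0ℚ v ⟩
    (Constant z × 0ℚ + suc s ×ℚ v zero ≡ 0ℚ × LocalConditions (os ++ rest) (0ℚ + suc (suc s) ×ℚ v zero) r)
      ≡⟨ cong₂ (λ x y → Constant z × x ≡ 0ℚ × LocalConditions (os ++ rest) y r)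
               (+-identityˡ (suc s ×ℚ v zero)) (+-identityˡ (suc (suc s) ×ℚ v zero)) ⟩
    (Constant z × suc s ×ℚ v zero ≡ 0ℚ × LocalConditions (os ++ rest) (suc (suc s) ×ℚ v zero) r)
      ≈⟨ Constant⇔Vanishing s z (λ P → LocalConditions (os ++ rest) P r) ⟩
    (Vanishing z × LocalConditions (os ++ rest) 0ℚ r)
      ≈⟨ ⇔-refl ×-⇔ LocalConditions⇔Balanced-ones t ps r ⟩
    Balanced ((suc s , t) ∷ ps) v ∎
    where
    open ⇔-Reasoning
    zs = replicate (suc (suc s)) false
    os = replicate (suc t) true
    rest = blockString ps
    z = v ∘ leftIndex zs (os ++ rest)
    r = v ∘ rightIndex zs (os ++ rest)

  InEigenspace₁⇔SumZero×Balanced : ∀ t ps v → let os = replicate (suc t) true in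
    InEigenspace₁ (blockString ((0 , t) ∷ ps)) v ⇔ SumZero×Balanced (false ∷ os) ps v
  InEigenspace₁⇔SumZero×Balanced t ps v = begin
    InEigenspace₁ (false ∷ os ++ rest) v
      ≈⟨ InEigenspace₁⇔LocalConditions (false ∷ os ++ rest) v ⟩
    (0ℚ ≡ 0ℚ × LocalConditions (os ++ rest) (0ℚ + v zero) (tail v))
      ≈⟨ mk⇔ proj₂ (refl ,_) ⟩
    LocalConditions (os ++ rest) (0ℚ + v zero) (tail v)
      ≈⟨ LocalConditions-ones t rest (0ℚ + v zero) (tail v) ⟩
    AfterOne rest (0ℚ + v zero + Σ) r
      ≡⟨ cong (λ Q → AfterOne rest (Q + Σ) r) (+-identityˡ (v zero)) ⟩
    AfterOne rest (v zero + Σ) r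
      ≈⟨ AfterOne⇔Balanced ps (v zero + Σ) r ⟩
    (v zero + Σ ≡ 0ℚ × Balanced ps r) ∎
    where
    open ⇔-Reasoning
    os = replicate (suc t) true
    rest = blockString ps
    Σ = Σℚ (length os) (tail v ∘ leftIndex os rest)
    r = tail v ∘ rightIndex os rest

  Balanced-respects : ∀ ps → Balanced ps Respects _≗_
  0∈Balanced : ∀ ps → Balanced ps (λ _ → 0ℚ)
  Balanced-pivotBasis : ∀ ps → PivotBasis (Balanced ps) (Fin (excess ps))

  SumZero×Balanced-respects : ∀ xs ps → SumZero×Balanced xs ps Respects _≗_
  SumZero×Balanced-respects xs ps = Product-respects xs _ SumZero-respects (Balanced-respects ps)

  0∈SumZero×Balanced : ∀ xs ps → SumZero×Balanced xs ps (λ _ → 0ℚ)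
  0∈SumZero×Balanced xs ps = 0∈SumZero (length xs) , 0∈Balanced ps

  SumZero×Balanced-pivotBasis : ∀ b t ps
    → PivotBasis (SumZero×Balanced (b ∷ replicate t true) ps) (Fin (t ℕ.+ excess ps))
  SumZero×Balanced-pivotBasis b t ps =
    subst (λ n → PivotBasis (SumZero×Balanced (b ∷ replicate t true) ps) (Fin (n ℕ.+ excess ps))) (length-replicate t)
      (Product-pivotBasis (b ∷ replicate t true) _ SumZero-respects (Balanced-respects ps)
        (0∈SumZero (length (b ∷ replicate t true))) (0∈Balanced ps)
        (SumZero-pivotBasis (length (replicate t true))) (Balanced-pivotBasis ps))

  Balanced-respects []             = Vanishing-respects
  Balanced-respects ((s , t) ∷ ps) =
    Product-respects (replicate (suc s) false) _ Vanishing-respects (SumZero×Balanced-respects (replicate (suc t) true) ps)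

  0∈Balanced []             = λ _ → refl
  0∈Balanced ((s , t) ∷ ps) = (λ _ → refl) , 0∈SumZero×Balanced (replicate (suc t) true) ps

  Balanced-pivotBasis []             = Vanishing-pivotBasis
  Balanced-pivotBasis ((s , t) ∷ ps) =
    Product-pivotBasis (replicate (suc s) false) _ Vanishing-respects (SumZero×Balanced-respects (replicate (suc t) true) ps)
      (λ _ → refl) (0∈SumZero×Balanced (replicate (suc t) true) ps)
      Vanishing-pivotBasis (SumZero×Balanced-pivotBasis true t ps)

  Multiplicity₁ : List Bool → ℕ → Set
  Multiplicity₁ b = EigenvalueMultiplicity (length b) (thresholdSeidel b) 1ℚ

  multiplicity₁-longFirstRun : ∀ s t ps → 1 ℕ.≤ s
    → Multiplicity₁ (blockString ((s , t) ∷ ps)) (excess ((s , t) ∷ ps))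
  multiplicity₁-longFirstRun (suc s) t ps _ =
    eigenvalueMultiplicity (thresholdSeidel (blockString ((suc s , t) ∷ ps))) 1ℚ
      (PivotBasis-⇔ (λ v → ⇔-sym (InEigenspace₁⇔Balanced s t ps v)) (Balanced-pivotBasis ((suc s , t) ∷ ps)))

  multiplicity₁-singleFirstZero : ∀ s t ps → s ≡ 0
    → Multiplicity₁ (blockString ((s , t) ∷ ps)) (suc (excess ((s , t) ∷ ps)))
  multiplicity₁-singleFirstZero zero t ps refl =
    eigenvalueMultiplicity (thresholdSeidel (blockString ((0 , t) ∷ ps))) 1ℚ
      (PivotBasis-⇔ (λ v → ⇔-sym (InEigenspace₁⇔SumZero×Balanced t ps v))
                    (SumZero×Balanced-pivotBasis false (suc t) ps))

open ThresholdSeidelEigenspace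
  using (blockString; excess; Multiplicity₁; multiplicity₁-longFirstRun; multiplicity₁-singleFirstZero)
open import Data.Nat using (pred; _∸_; _+_; _≤_; _>_; >-nonZero)
open import Data.Nat.Properties using (+-suc; m+n∸n≡m; +-comm; +-assoc; pred-mono-≤; suc-pred)
open import Data.Rational using (1ℚ)

-- Threshold strings as block strings

module _ {k : ℕ} (s t : Fin k → ℕ) where

  blocks : List (Fin k) → List (ℕ × ℕ)
  blocks = map (λ i → pred (s i) , pred (t i))

  concatMap≡blockString : (∀ i → 1 ≤ s i) → (∀ i → 1 ≤ t i) → ∀ is
    → concatMap (λ i → replicate (s i) false ++ replicate (t i) true) is ≡ blockString (blocks is)
  concatMap≡blockString s≥1 t≥1 []       = refl
  concatMap≡blockString s≥1 t≥1 (i ∷ is) = trans (++-assoc (replicate (s i) false) (replicate (t i) true) _)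
    (cong₂ (λ m xs → replicate m false ++ xs) (sym (suc-pred (s i) {{>-nonZero (s≥1 i)}}))
      (cong₂ (λ n xs → replicate n true ++ xs) (sym (suc-pred (t i) {{>-nonZero (t≥1 i)}}))
        (concatMap≡blockString s≥1 t≥1 is)))

  sum≡excess+length : (∀ i → 1 ≤ t i) → ∀ is → sum (map t is) ≡ excess (blocks is) + length is
  sum≡excess+length t≥1 []       = refl
  sum≡excess+length t≥1 (i ∷ is) = begin
    t i + sum (map t is)                ≡⟨ cong₂ _+_ (sym (suc-pred (t i) {{>-nonZero (t≥1 i)}})) (sum≡excess+length t≥1 is) ⟩
    suc (pred (t i) + (E + length is))  ≡˘⟨ cong suc (+-assoc (pred (t i)) E (length is)) ⟩
    suc (pred (t i) + E + length is)    ≡˘⟨ +-suc (pred (t i) + E) (length is) ⟩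
    pred (t i) + E + suc (length is)    ∎
    where
    open ≡-Reasoning
    E = excess (blocks is)

  sumFin∸k≡excess : (∀ i → 1 ≤ t i) → sumFin k t ∸ k ≡ excess (blocks (allFin k))
  sumFin∸k≡excess t≥1 = begin
    sum (map t (allFin k)) ∸ k                ≡⟨ cong (_∸ k) (sum≡excess+length t≥1 (allFin k)) ⟩
    E + length (allFin k) ∸ k                 ≡⟨ cong (λ n → E + n ∸ k) (length-tabulate id) ⟩
    E + k ∸ k                                 ≡⟨ m+n∸n≡m E k ⟩
    E                                         ∎
    where
    open ≡-Reasoning
    E = excess (blocks (allFin k))

mainTheorem7 : (k : ℕ) → (s t : Fin (suc k) → ℕ)
    → ((i : Fin (suc k)) → 1 ≤ s i) → ((i : Fin (suc k)) → 1 ≤ t i)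
    → (s zero > 1 → EigenvalueMultiplicity (length (thresholdString (suc k) s t)) (thresholdSeidel (thresholdString (suc k) s t)) 1ℚ (sumFin (suc k) t ∸ suc k))
      × (s zero ≡ 1 → EigenvalueMultiplicity (length (thresholdString (suc k) s t)) (thresholdSeidel (thresholdString (suc k) s t)) 1ℚ (sumFin (suc k) t ∸ suc k + 1))
mainTheorem7 k s t s≥1 t≥1 =
  (λ s₀>1 → subst₂ Multiplicity₁ (sym string≡) (sym count≡)
              (multiplicity₁-longFirstRun (pred (s zero)) (pred (t zero)) rest (pred-mono-≤ s₀>1))) ,
  (λ s₀≡1 → subst₂ Multiplicity₁ (sym string≡) (sym (trans (cong (_+ 1) count≡) (+-comm _ 1)))
              (multiplicity₁-singleFirstZero (pred (s zero)) (pred (t zero)) rest (cong pred s₀≡1)))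
  where
  -- allFin (suc k) unfolds to zero ∷ tabulate suc, so the block list starts with the first block.
  rest : List (ℕ × ℕ)
  rest = blocks s t (tabulate suc)
  string≡ : thresholdString (suc k) s t ≡ blockString (blocks s t (allFin (suc k)))
  string≡ = concatMap≡blockString s t s≥1 t≥1 (allFin (suc k))
  count≡ : sumFin (suc k) t ∸ suc k ≡ excess (blocks s t (allFin (suc k)))
  count≡ = sumFin∸k≡excess s t t≥1
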